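{- Fix integers $k\geq 1$ and $\beta\geq 0$. Let $G$ be an $F_k$-free graph with a partition $V(G)=X\cup Y$, and suppose that every edge $xx'$ of $G[X]$ has at least $|Y|-\beta$ common neighbors in $Y$ (i.e. $|N_G(x)\cap N_G(x')\cap Y|\ge |Y|-\beta$). If $|Y|$ is sufficiently large in terms of $k$ and $\beta$, then $\nu(G[X])\le k-1$ and $\Delta(G[X])\le k-1$. The symmetric statement holds with $X$ and $Y$ interchanged.
   Context: The friendship graph $F_k$ consists of $k$ triangles sharing one common vertex; $F_k$-free means containing no copy of $F_k$ as a subgraph. $\nu(H)$ is the matching number and $\Delta(H)$ the maximum degree of $H$; $G[X]$ is the subgraph induced by $X$. -}

module Defs where

open import Data.Nat using (ℕ; suc; _≤_; _∸_)
open import Data.Fin using (Fin)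
open import Data.Fin.Subset using (Subset; ∣_∣)
open import Data.Vec using (tabulate)
open import Data.Bool using (Bool; true; false; not; _∧_)
open import Data.Product using (Σ; _×_; proj₁; proj₂)
open import Relation.Binary.PropositionalEquality using (_≡_; _≢_)
open import Relation.Nullary using (¬_)

record Graph (n : ℕ) : Set where
  field
    adj   : Fin n → Fin n → Bool
    sym   : ∀ u v → adj u v ≡ adj v u
    irrefl : ∀ v → adj v v ≡ false
open Graph public

Adj : ∀ {n} → Graph n → Fin n → Fin n → Set
Adj G u v = adj G u v ≡ true

VSet : ℕ → Set
VSet n = Fin n → Bool

_∈S_ : ∀ {n} → Fin n → VSet n → Set
v ∈S S = S v ≡ true

compl : ∀ {n} → VSet n → VSet n
compl S v = not (S v)

card : ∀ {n} → VSet n → ℕ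
card S = ∣ tabulate S ∣

-- A copy of the friendship graph F_k in G: centre c, triangles c a_i b_i,
-- with all 2k+1 vertices pairwise distinct.
FkCopy : ∀ {n} → ℕ → Graph n → Set
FkCopy {n} k G =
  Σ (Fin n) λ c → Σ (Fin k → Fin n) λ a → Σ (Fin k → Fin n) λ b →
    (∀ i → Adj G c (a i) × Adj G c (b i) × Adj G (a i) (b i)) ×
    (∀ i → c ≢ a i × c ≢ b i) ×
    (∀ i j → a i ≢ b j) ×
    (∀ i j → i ≢ j → a i ≢ a j × b i ≢ b j)

FkFree : ∀ {n} → ℕ → Graph n → Set
FkFree k G = ¬ FkCopy k G

Matching : ∀ {n} → Graph n → VSet n → ℕ → Set
Matching {n} G S m =
  Σ (Fin m → Fin n × Fin n) λ e →
    (∀ i → proj₁ (e i) ∈S S × proj₂ (e i) ∈S S × Adj G (proj₁ (e i)) (proj₂ (e i))) ×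
    (∀ i j → i ≢ j →
       proj₁ (e i) ≢ proj₁ (e j) × proj₁ (e i) ≢ proj₂ (e j) ×
       proj₂ (e i) ≢ proj₁ (e j) × proj₂ (e i) ≢ proj₂ (e j))

MatchingNumber≤ : ∀ {n} → Graph n → VSet n → ℕ → Set
MatchingNumber≤ G S t = ∀ m → Matching G S m → m ≤ t

degIn : ∀ {n} → Graph n → VSet n → Fin n → ℕ
degIn G S v = card (λ u → S u ∧ adj G v u)

MaxDegree≤ : ∀ {n} → Graph n → VSet n → ℕ → Set
MaxDegree≤ G S t = ∀ v → v ∈S S → degIn G S v ≤ t

commonIn : ∀ {n} → Graph n → VSet n → Fin n → Fin n → ℕ
commonIn G T u w = card (λ y → T y ∧ (adj G u y ∧ adj G w y))

EdgesHaveCommonNbrs : ∀ {n} → Graph n → VSet n → VSet n → ℕ → Set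
EdgesHaveCommonNbrs G S T β =
  ∀ x x' → x ∈S S → x' ∈S S → Adj G x x' → card T ∸ β ≤ commonIn G T x x'

-- Take N = max (kβ + 1) (k + β) and write T for the side that supplies common
-- neighbours.  Given k disjoint edges in G[S], each one misses at most β vertices
-- of T from its common neighbourhood, so together they miss at most kβ < |T|;
-- a vertex of T adjacent to all 2k endpoints is the centre of an F_k.  Given a
-- vertex v with k neighbours u₁, …, u_k in S, every edge v uᵢ has at least
-- |T| - β ≥ k common neighbours in T, so distinct wᵢ can be chosen greedily and
-- the triangles v uᵢ wᵢ form an F_k centred at v.
{-# OPTIONS --safe #-}
module Submission where

open import Defs
open import Data.Bool using (_∧_)
open import Data.Bool.Properties using (not-¬)
open import Data.Fin using (Fin; zero; suc; inject≤; _≟_)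
open import Data.Fin.Properties using (inject≤-injective)
open import Data.Fin.Subset
  using (Subset; inside; outside; _∈_; _∉_; _∩_; _∪_; ∁; ⋃; ⁅_⁆; ∣_∣; Nonempty)
open import Data.Fin.Subset.Properties
  using ( ∣p∣≤∣x∷p∣; ∣⊥∣≡0; ∣⁅x⁆∣≡1; x∈⁅x⁆; nonempty?; Empty-unique
        ; x∈p∩q⁺; x∈p∩q⁻; ∣p∩q∣≤∣q∣; x∈p∪q⁺; x∈∁p⇒x∉p; x∉∁p⇒x∈p )
import Data.List as List
open import Data.Nat
  using (ℕ; zero; suc; _+_; _*_; _∸_; _⊔_; _≤_; _<_; z≤n; s≤s)
open import Data.Nat.Properties
  using ( ≤-trans; ≤-reflexive; <⇒≤; <⇒≢; ≤-<-trans; <-≤-trans; ≰⇒>; +-suc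
        ; +-monoʳ-≤; +-mono-≤; +-cancelʳ-≤; +-cancelʳ-<; *-identityʳ; ∸-monoˡ-≤
        ; m≤n+m∸n; m+n≤o⇒m≤o∸n; m≤m⊔n; m≤n⊔m; module ≤-Reasoning )
open import Data.Product using (Σ; ∃; _×_; _,_; proj₁; proj₂)
open import Data.Sum using (inj₁; inj₂)
open import Data.Vec using (_∷_; []; tabulate)
open import Data.Vec.Properties using (lookup∘tabulate; []=⇒lookup)
import Data.Vec.Functional as Vector
open import Function using (_∘_; flip; Injective)
open import Relation.Binary.PropositionalEquality as ≡
  using (_≡_; _≢_; refl; cong; subst)
open import Relation.Nullary using (¬_; yes; no; contradiction)
open import Relation.Nullary.Decidable using (decidable-stable)

private
  variable
    j k m n β : ℕ

∣p∪q∣≤∣p∣+∣q∣ : (p q : Subset n) → ∣ p ∪ q ∣ ≤ ∣ p ∣ + ∣ q ∣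
∣p∪q∣≤∣p∣+∣q∣ []            []            = z≤n
∣p∪q∣≤∣p∣+∣q∣ (inside  ∷ p) (s ∷ q)       =
  s≤s (≤-trans (∣p∪q∣≤∣p∣+∣q∣ p q) (+-monoʳ-≤ (∣ p ∣) (∣p∣≤∣x∷p∣ s q)))
∣p∪q∣≤∣p∣+∣q∣ (outside ∷ p) (inside  ∷ q) =
  ≤-trans (s≤s (∣p∪q∣≤∣p∣+∣q∣ p q)) (≤-reflexive (≡.sym (+-suc (∣ p ∣) (∣ q ∣))))
∣p∪q∣≤∣p∣+∣q∣ (outside ∷ p) (outside ∷ q) = ∣p∪q∣≤∣p∣+∣q∣ p q

∣p∩∁q∣+∣p∩q∣≡∣p∣ : (p q : Subset n) → ∣ p ∩ ∁ q ∣ + ∣ p ∩ q ∣ ≡ ∣ p ∣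
∣p∩∁q∣+∣p∩q∣≡∣p∣ []            []            = refl
∣p∩∁q∣+∣p∩q∣≡∣p∣ (inside  ∷ p) (inside  ∷ q) =
  ≡.trans (+-suc (∣ p ∩ ∁ q ∣) (∣ p ∩ q ∣)) (cong suc (∣p∩∁q∣+∣p∩q∣≡∣p∣ p q))
∣p∩∁q∣+∣p∩q∣≡∣p∣ (inside  ∷ p) (outside ∷ q) = cong suc (∣p∩∁q∣+∣p∩q∣≡∣p∣ p q)
∣p∩∁q∣+∣p∩q∣≡∣p∣ (outside ∷ p) (_       ∷ q) = ∣p∩∁q∣+∣p∩q∣≡∣p∣ p q

∣p∣>0⇒Nonempty : (p : Subset n) → 0 < ∣ p ∣ → Nonempty p
∣p∣>0⇒Nonempty {n} p 0<∣p∣ = decidable-stable (nonempty? p) λ empty →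
  <⇒≢ 0<∣p∣ (≡.sym (≡.trans (cong ∣_∣ (Empty-unique empty)) (∣⊥∣≡0 n)))

∣q∣<∣p∣⇒∃[x∈p∖q] : (p q : Subset n) → ∣ q ∣ < ∣ p ∣ → ∃ λ x → x ∈ p × x ∉ q
∣q∣<∣p∣⇒∃[x∈p∖q] p q ∣q∣<∣p∣ =
  let x , x∈p∩∁q = ∣p∣>0⇒Nonempty (p ∩ ∁ q) 0<∣p∩∁q∣
      x∈p , x∈∁q = x∈p∩q⁻ p (∁ q) x∈p∩∁q
  in  x , x∈p , x∈∁p⇒x∉p x∈∁q
  where
  0<∣p∩∁q∣ : 0 < ∣ p ∩ ∁ q ∣
  0<∣p∩∁q∣ = +-cancelʳ-< (∣ p ∩ q ∣) 0 (∣ p ∩ ∁ q ∣)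
    (≤-<-trans (∣p∩q∣≤∣q∣ p q)
      (<-≤-trans ∣q∣<∣p∣ (≤-reflexive (≡.sym (∣p∩∁q∣+∣p∩q∣≡∣p∣ p q)))))

∣p∩∁q∣≤β : (p q : Subset n) → ∣ p ∣ ∸ β ≤ ∣ p ∩ q ∣ → ∣ p ∩ ∁ q ∣ ≤ β
∣p∩∁q∣≤β {β = β} p q large = +-cancelʳ-≤ (∣ p ∩ q ∣) (∣ p ∩ ∁ q ∣) β (begin
  ∣ p ∩ ∁ q ∣ + ∣ p ∩ q ∣ ≡⟨ ∣p∩∁q∣+∣p∩q∣≡∣p∣ p q ⟩
  ∣ p ∣                   ≤⟨ m≤n+m∸n (∣ p ∣) β ⟩
  β + (∣ p ∣ ∸ β)         ≤⟨ +-monoʳ-≤ β large ⟩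
  β + ∣ p ∩ q ∣           ∎)
  where open ≤-Reasoning

∣⋃∣≤* : (p : Fin j → Subset n) → (∀ i → ∣ p i ∣ ≤ β) →
        ∣ ⋃ (List.tabulate p) ∣ ≤ j * β
∣⋃∣≤* {zero}  {n} p bound = ≤-reflexive (∣⊥∣≡0 n)
∣⋃∣≤* {suc j}     p bound = ≤-trans (∣p∪q∣≤∣p∣+∣q∣ (p zero) _)
  (+-mono-≤ (bound zero) (∣⋃∣≤* (p ∘ suc) (bound ∘ suc)))

x∈p[i]⇒x∈⋃p : (p : Fin j → Subset n) (i : Fin j) {x : Fin n} →
              x ∈ p i → x ∈ ⋃ (List.tabulate p)
x∈p[i]⇒x∈⋃p p zero    x∈p₀ = x∈p∪q⁺ (inj₁ x∈p₀)
x∈p[i]⇒x∈⋃p p (suc i) x∈pᵢ = x∈p∪q⁺ (inj₂ (x∈p[i]⇒x∈⋃p (p ∘ suc) i x∈pᵢ))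

-- Each q i misses at most β points of p, so all of them together miss at most j β.
common-element : (p : Subset n) (q : Fin j → Subset n) →
                 (∀ i → ∣ p ∣ ∸ β ≤ ∣ p ∩ q i ∣) → j * β < ∣ p ∣ →
                 ∃ λ x → x ∈ p × ∀ i → x ∈ q i
common-element {n} {j} {β} p q large small =
  let x , x∈p , x∉missed = ∣q∣<∣p∣⇒∃[x∈p∖q] p (⋃ (List.tabulate missed))
        (≤-<-trans (∣⋃∣≤* missed (λ i → ∣p∩∁q∣≤β p (q i) (large i))) small)
  in  x , x∈p , λ i → x∉∁p⇒x∈p λ x∈∁qᵢ →
        x∉missed (x∈p[i]⇒x∈⋃p missed i (x∈p∩q⁺ (x∈p , x∈∁qᵢ)))
  where
  missed : Fin j → Subset n
  missed i = p ∩ ∁ (q i)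

∷-injective : {x : Fin n} {r : Fin j → Fin n} → (∀ i → x ≢ r i) →
              Injective _≡_ _≡_ r → Injective _≡_ _≡_ (x Vector.∷ r)
∷-injective fresh r-inj {zero}  {zero}  _  = refl
∷-injective fresh r-inj {zero}  {suc j} eq = contradiction eq (fresh j)
∷-injective fresh r-inj {suc i} {zero}  eq = contradiction (≡.sym eq) (fresh i)
∷-injective fresh r-inj {suc i} {suc j} eq = cong suc (r-inj eq)

DistinctRepresentatives : (Fin j → Subset n) → Set
DistinctRepresentatives {j} {n} B =
  Σ (Fin j → Fin n) λ r → (∀ i → r i ∈ B i) × Injective _≡_ _≡_ r

-- The representatives of the other j sets occupy only j points of B zero.
DistinctRepresentatives-∷ : (B : Fin (suc j) → Subset n) → j < ∣ B zero ∣ →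
                            DistinctRepresentatives (B ∘ suc) → DistinctRepresentatives B
DistinctRepresentatives-∷ {j} {n} B large (r , r∈B , r-inj) =
  let x , x∈B₀ , x∉image = ∣q∣<∣p∣⇒∃[x∈p∖q] (B zero) image (≤-<-trans ∣image∣≤j large)
  in  x Vector.∷ r
    , (λ { zero → x∈B₀ ; (suc i) → r∈B i })
    , ∷-injective (λ i x≡rᵢ → x∉image (subst (_∈ image) (≡.sym x≡rᵢ) (rᵢ∈image i))) r-inj
  where
  image : Subset n
  image = ⋃ (List.tabulate (⁅_⁆ ∘ r))
  rᵢ∈image : ∀ i → r i ∈ image
  rᵢ∈image i = x∈p[i]⇒x∈⋃p (⁅_⁆ ∘ r) i (x∈⁅x⁆ (r i))
  ∣image∣≤j : ∣ image ∣ ≤ j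
  ∣image∣≤j = ≤-trans (∣⋃∣≤* (⁅_⁆ ∘ r) (≤-reflexive ∘ ∣⁅x⁆∣≡1 ∘ r))
                      (≤-reflexive (*-identityʳ j))

distinct-representatives : (B : Fin j → Subset n) → (∀ i → j ≤ ∣ B i ∣) →
                           DistinctRepresentatives B
distinct-representatives {zero}  B large = (λ ()) , (λ ()) , λ { {()} }
distinct-representatives {suc j} B large = DistinctRepresentatives-∷ B (large zero)
  (distinct-representatives (B ∘ suc) (<⇒≤ ∘ large ∘ suc))

⟦_⟧ : VSet n → Subset n
⟦_⟧ = tabulate

nbhd : Graph n → Fin n → Subset n
nbhd G v = ⟦ adj G v ⟧

∈⟦⟧⁻ : (P : VSet n) {x : Fin n} → x ∈ ⟦ P ⟧ → x ∈S P
∈⟦⟧⁻ P {x} x∈P = ≡.trans (≡.sym (lookup∘tabulate P x)) ([]=⇒lookup x∈P)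

⟦∧⟧ : (P Q : VSet n) → ⟦ (λ x → P x ∧ Q x) ⟧ ≡ ⟦ P ⟧ ∩ ⟦ Q ⟧
⟦∧⟧ {zero}  P Q = refl
⟦∧⟧ {suc n} P Q = cong (P zero ∧ Q zero ∷_) (⟦∧⟧ (P ∘ suc) (Q ∘ suc))

commonIn≡∣T∩N∩N∣ : (G : Graph n) (T : VSet n) (u w : Fin n) →
                   commonIn G T u w ≡ ∣ ⟦ T ⟧ ∩ nbhd G u ∩ nbhd G w ∣
commonIn≡∣T∩N∩N∣ G T u w =
  cong ∣_∣ (≡.trans (⟦∧⟧ T _) (cong (⟦ T ⟧ ∩_) (⟦∧⟧ (adj G u) (adj G w))))

degIn≡∣S∩N∣ : (G : Graph n) (S : VSet n) (v : Fin n) → degIn G S v ≡ ∣ ⟦ S ⟧ ∩ nbhd G v ∣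
degIn≡∣S∩N∣ G S v = cong ∣_∣ (⟦∧⟧ S (adj G v))

Adj-sym : (G : Graph n) {u v : Fin n} → Adj G u v → Adj G v u
Adj-sym G {u} {v} u~v = ≡.trans (sym G v u) u~v

Adj⇒≢ : (G : Graph n) {u v : Fin n} → Adj G u v → u ≢ v
Adj⇒≢ G {u} u~u refl = contradiction (≡.trans (≡.sym u~u) (irrefl G u)) λ ()

Disjoint : VSet n → VSet n → Set
Disjoint S T = ∀ {x} → x ∈S S → ¬ x ∈S T

compl-disjointˡ : (X : VSet n) → Disjoint X (compl X)
compl-disjointˡ X x∈X x∈∁X = not-¬ refl (≡.trans x∈X (≡.sym x∈∁X))

compl-disjointʳ : (X : VSet n) → Disjoint (compl X) X
compl-disjointʳ X = flip (compl-disjointˡ X)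

fkCopy : (G : Graph n) (c : Fin n) (a b : Fin k → Fin n) →
         (∀ i → Adj G c (a i) × Adj G c (b i) × Adj G (a i) (b i)) →
         (∀ i j → a i ≢ b j) → Injective _≡_ _≡_ a → Injective _≡_ _≡_ b →
         FkCopy k G
fkCopy G c a b triangles a≢b a-inj b-inj =
  c , a , b , triangles ,
  (λ i → let c~aᵢ , c~bᵢ , _ = triangles i in Adj⇒≢ G c~aᵢ , Adj⇒≢ G c~bᵢ) ,
  a≢b ,
  λ i j i≢j → i≢j ∘ a-inj , i≢j ∘ b-inj

Matching-shrink : {G : Graph n} {S : VSet n} {m m′ : ℕ} → m ≤ m′ →
                  Matching G S m′ → Matching G S m
Matching-shrink {m = m} {m′} m≤m′ (e , edges , disjoint) =
  e ∘ inject , edges ∘ inject ,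
  λ i j i≢j → disjoint (inject i) (inject j) (i≢j ∘ inject≤-injective m≤m′ m≤m′ i j)
  where
  inject : Fin m → Fin m′
  inject i = inject≤ i m≤m′

FkCopy-from-Matching : (G : Graph n) {S : VSet n} ((e , _) : Matching G S k) (y : Fin n) →
                       (∀ i → Adj G y (proj₁ (e i)) × Adj G y (proj₂ (e i))) →
                       FkCopy k G
FkCopy-from-Matching G (e , edges , disjoint) y y~ends =
  fkCopy G y (proj₁ ∘ e) (proj₂ ∘ e)
    (λ i → proj₁ (y~ends i) , proj₂ (y~ends i) , proj₂ (proj₂ (edges i)))
    a≢b
    (λ {i} {j} eq → decidable-stable (i ≟ j) λ i≢j → proj₁ (disjoint i j i≢j) eq)
    (λ {i} {j} eq → decidable-stable (i ≟ j) λ i≢j →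
                      proj₂ (proj₂ (proj₂ (disjoint i j i≢j))) eq)
  where
  a≢b : ∀ i j → proj₁ (e i) ≢ proj₂ (e j)
  a≢b i j with i ≟ j
  ... | yes refl = Adj⇒≢ G (proj₂ (proj₂ (edges i)))
  ... | no  i≢j  = proj₁ (proj₂ (disjoint i j i≢j))

FkFree⇒¬Matching : (G : Graph n) (S T : VSet n) → FkFree k G →
                   EdgesHaveCommonNbrs G S T β → k * β < card T → ¬ Matching G S k
FkFree⇒¬Matching {n} {k} {β} G S T free common large M@(e , edges , _) =
  let y , _ , y∈N∩N = common-element ⟦ T ⟧ (λ i → nbhd G (x i) ∩ nbhd G (x′ i))
                        (λ i → subst (card T ∸ β ≤_) (commonIn≡∣T∩N∩N∣ G T (x i) (x′ i))
                                 (common-neighbours i))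
                        large
      y~ends : ∀ i → Adj G y (x i) × Adj G y (x′ i)
      y~ends i = let y∈Nxᵢ , y∈Nx′ᵢ = x∈p∩q⁻ (nbhd G (x i)) _ (y∈N∩N i)
                 in  Adj-sym G (∈⟦⟧⁻ _ y∈Nxᵢ) , Adj-sym G (∈⟦⟧⁻ _ y∈Nx′ᵢ)
  in  free (FkCopy-from-Matching G {S} M y y~ends)
  where
  x x′ : Fin k → Fin n
  x  = proj₁ ∘ e
  x′ = proj₂ ∘ e
  common-neighbours : ∀ i → card T ∸ β ≤ commonIn G T (x i) (x′ i)
  common-neighbours i = let x∈S , x′∈S , x~x′ = edges i in common _ _ x∈S x′∈S x~x′

FkFree⇒¬k≤degIn : (G : Graph n) (S T : VSet n) {v : Fin n} → Disjoint S T →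
                  FkFree k G → EdgesHaveCommonNbrs G S T β → k + β ≤ card T → v ∈S S →
                  ¬ (k ≤ degIn G S v)
FkFree⇒¬k≤degIn {n} {k} {β} G S T {v} S∩T=∅ free common large v∈S k≤deg =
  free (fkCopy G v u w triangles u≢w u-inj w-inj)
  where
  u-reps : DistinctRepresentatives {k} (λ _ → ⟦ S ⟧ ∩ nbhd G v)
  u-reps = distinct-representatives _ (λ _ → subst (k ≤_) (degIn≡∣S∩N∣ G S v) k≤deg)
  u : Fin k → Fin n
  u = proj₁ u-reps
  u-inj : Injective _≡_ _≡_ u
  u-inj = proj₂ (proj₂ u-reps)
  u∈S : ∀ i → u i ∈S S
  u∈S i = ∈⟦⟧⁻ S (proj₁ (x∈p∩q⁻ ⟦ S ⟧ _ (proj₁ (proj₂ u-reps) i)))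
  v~u : ∀ i → Adj G v (u i)
  v~u i = ∈⟦⟧⁻ (adj G v) (proj₂ (x∈p∩q⁻ ⟦ S ⟧ _ (proj₁ (proj₂ u-reps) i)))
  w-reps : DistinctRepresentatives (λ i → ⟦ T ⟧ ∩ nbhd G v ∩ nbhd G (u i))
  w-reps = distinct-representatives _ λ i →
    ≤-trans (m+n≤o⇒m≤o∸n k large)
      (subst (card T ∸ β ≤_) (commonIn≡∣T∩N∩N∣ G T v (u i))
        (common v (u i) v∈S (u∈S i) (v~u i)))
  w : Fin k → Fin n
  w = proj₁ w-reps
  w-inj : Injective _≡_ _≡_ w
  w-inj = proj₂ (proj₂ w-reps)
  w∈T∩N∩N : ∀ i → w i ∈S T × Adj G v (w i) × Adj G (u i) (w i)
  w∈T∩N∩N i =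
    let w∈T , w∈N∩N = x∈p∩q⁻ ⟦ T ⟧ _ (proj₁ (proj₂ w-reps) i)
        w∈Nv , w∈Nu = x∈p∩q⁻ (nbhd G v) _ w∈N∩N
    in  ∈⟦⟧⁻ T w∈T , ∈⟦⟧⁻ (adj G v) w∈Nv , ∈⟦⟧⁻ (adj G (u i)) w∈Nu
  triangles : ∀ i → Adj G v (u i) × Adj G v (w i) × Adj G (u i) (w i)
  triangles i = v~u i , proj₂ (w∈T∩N∩N i)
  u≢w : ∀ i j → u i ≢ w j
  u≢w i j uᵢ≡wⱼ = S∩T=∅ (u∈S i) (subst (_∈S T) (≡.sym uᵢ≡wⱼ) (proj₁ (w∈T∩N∩N j)))

≱⇒≤∸1 : ¬ (k ≤ m) → m ≤ k ∸ 1
≱⇒≤∸1 k≰m = ∸-monoˡ-≤ 1 (≰⇒> k≰m)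

FkFree⇒ν≤k∸1∧Δ≤k∸1 : (G : Graph n) (S T : VSet n) → Disjoint S T → FkFree k G →
  EdgesHaveCommonNbrs G S T β → suc (k * β) ⊔ (k + β) ≤ card T →
  MatchingNumber≤ G S (k ∸ 1) × MaxDegree≤ G S (k ∸ 1)
FkFree⇒ν≤k∸1∧Δ≤k∸1 {k = k} {β} G S T S∩T=∅ free common large =
  (λ m M → ≱⇒≤∸1 {k} (no-k-Matching ∘ flip (Matching-shrink {G = G} {S}) M)) ,
  (λ v v∈S → ≱⇒≤∸1 {k} (FkFree⇒¬k≤degIn G S T S∩T=∅ free common k+β≤∣T∣ v∈S))
  where
  no-k-Matching : ¬ Matching G S k
  no-k-Matching =
    FkFree⇒¬Matching G S T free common (≤-trans (m≤m⊔n (suc (k * β)) (k + β)) large)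
  k+β≤∣T∣ : k + β ≤ card T
  k+β≤∣T∣ = ≤-trans (m≤n⊔m (suc (k * β)) (k + β)) large

lemma4p3 : (k β : ℕ) → 1 ≤ k →
    Σ ℕ λ N →
      ((n : ℕ) (G : Graph n) (X : VSet n) → FkFree k G →
        EdgesHaveCommonNbrs G X (compl X) β → N ≤ card (compl X) →
        MatchingNumber≤ G X (k ∸ 1) × MaxDegree≤ G X (k ∸ 1))
      ×
      ((n : ℕ) (G : Graph n) (X : VSet n) → FkFree k G →
        EdgesHaveCommonNbrs G (compl X) X β → N ≤ card X →
        MatchingNumber≤ G (compl X) (k ∸ 1) × MaxDegree≤ G (compl X) (k ∸ 1))
lemma4p3 k β _ =
  suc (k * β) ⊔ (k + β) ,
  (λ n G X → FkFree⇒ν≤k∸1∧Δ≤k∸1 G X (compl X) (compl-disjointˡ X)) ,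
  (λ n G X → FkFree⇒ν≤k∸1∧Δ≤k∸1 G (compl X) X (compl-disjointʳ X))
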